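{- Let $u\in L_{\mathrm{up}}$ and $(\ell_1,\ell_2)\in A_u$. Then (i) $\mathrm{apex}(\ell_1)$ is a strict ancestor of $\mathrm{apex}(\ell_2)$ in the tree $G$, and (ii) $P_{u,\ell_1}$ is the edge set of a subpath of the $\mathrm{apex}(\ell_1)$-$\mathrm{apex}(\ell_2)$ path in $G$.
   Context: Let $G=(V,E)$ be a tree with links $L\subseteq\binom{V}{2}$, and fix a root $r\in V$. For a link $\ell$, $P_\ell$ is the edge set of the path in $G$ between its endpoints and $V_\ell$ its vertex set. $z$ is an ancestor of $v$ if $z$ lies on the $r$-$v$ path (including $r,v$); strict ancestor means additionally $z\neq v$; descendant is the converse. $\mathrm{apex}(\ell)$ is the vertex of $V_\ell$ closest to $r$. An up-link is a link $\{t,b\}$ with $t$ an ancestor of $b$; $L_{\mathrm{up}}$ is the set of up-links. Let $F\subseteq L$ satisfy $\bigcup_{\ell\in F}P_\ell=E$. For $v\in V$ let $B_v=\{\ell\in F\colon \mathrm{apex}(\ell)\text{ is a descendant of }v\}$. For $u=\{t,b\}\in L_{\mathrm{up}}$ with $t$ an ancestor of $b$, let $v_u$ be the ancestor of $t$ farthest from $r$ with $P_u\subseteq\bigcup_{\ell\in B_{v_u}}P_\ell$, and let $F_u\subseteq B_{v_u}$ be a fixed inclusion-wise minimal set with $P_u\subseteq\bigcup_{\ell\in F_u}P_\ell$. For $\ell\in F_u$, $P_{u,\ell}:=P_u\setminus\bigcup_{\bar\ell\in F_u\setminus\{\ell\}}P_{\bar\ell}$; these sets are nonempty, pairwise disjoint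 edge sets of subpaths of the $t$-$b$ path. Define $\ell_1\prec_u\ell_2$ iff the edges of $P_{u,\ell_1}$ appear before those of $P_{u,\ell_2}$ on the $t$-$b$ path in $G$ (a total order on $F_u$). If $\ell_1\prec_u\cdots\prec_u\ell_q$ are the links of $F_u$, then $A_u:=\{(\ell_i,\ell_{i+1})\colon i=1,\dots,q-1\}$. -}

module Defs where

open import Level using (Level; suc; zero)
open import Data.Nat using (ℕ; _≤_; _<_)
import Data.Nat as N
open import Data.Fin using (Fin)
open import Data.Product using (Σ; ∃; ∃-syntax; _×_; _,_; proj₁; proj₂)
open import Data.Sum using (_⊎_)
open import Relation.Binary.PropositionalEquality using (_≡_; _≢_)
open import Relation.Nullary using (¬_)

-- A link {s,t} is represented by an ordered pair (s , t); all notions below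
-- are symmetric in the two endpoints.
Link : ℕ → Set
Link n = Fin n × Fin n

LinkSet : ℕ → Set₁
LinkSet n = Link n → Set

-- A rooted tree on the vertex set Fin n is given by a parent function and a
-- root r: the edges are {c , parent c} for c ≢ r (edge identified with its
-- child endpoint c).
module Tree {n : ℕ} (parent : Fin n → Fin n) (root : Fin n) where

  iter : ℕ → Fin n → Fin n
  iter ℕ.zero v = v
  iter (ℕ.suc k) v = parent (iter k v)

  Anc : Fin n → Fin n → Set
  Anc z v = ∃[ k ] (iter k v ≡ z)

  StrictAnc : Fin n → Fin n → Set
  StrictAnc z v = Anc z v × z ≢ v

  Depth : Fin n → ℕ → Set
  Depth v k = (iter k v ≡ root) × (∀ j → j < k → iter j v ≢ root)

  IsEdge : Fin n → Set
  IsEdge c = c ≢ root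

  -- PathE a b c : the edge {c , parent c} lies on the a–b path in the tree
  PathE : Fin n → Fin n → Fin n → Set
  PathE a b c = (Anc c a × ¬ Anc c b) ⊎ (Anc c b × ¬ Anc c a)

  PathV : Fin n → Fin n → Fin n → Set
  PathV a b z = z ≡ a ⊎ (z ≡ b ⊎ ∃[ c ] (PathE a b c × (z ≡ c ⊎ z ≡ parent c)))

  PE : Link n → Fin n → Set
  PE ℓ = PathE (proj₁ ℓ) (proj₂ ℓ)

  VE : Link n → Fin n → Set
  VE ℓ = PathV (proj₁ ℓ) (proj₂ ℓ)

  IsApex : Link n → Fin n → Set
  IsApex ℓ z = VE ℓ z × (∀ w → VE ℓ w → ∀ dz dw → Depth z dz → Depth w dw → dz ≤ dw)

  Covers : LinkSet n → (Fin n → Set) → Set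
  Covers S X = ∀ c → X c → ∃[ ℓ ] (S ℓ × PE ℓ c)

  B : LinkSet n → Fin n → LinkSet n
  B F v ℓ = F ℓ × ∃[ z ] (IsApex ℓ z × Anc v z)

  -- v is v_u for the up-link u = {t , b} (t ancestor of b): the ancestor of t
  -- farthest from the root with P_u ⊆ ⋃_{ℓ ∈ B_v} P_ℓ
  IsVu : LinkSet n → Fin n → Fin n → Fin n → Set
  IsVu F t b v =
    Anc v t × Covers (B F v) (PathE t b) ×
    (∀ w → Anc w t → Covers (B F w) (PathE t b) →
       ∀ dv dw → Depth v dv → Depth w dw → dw ≤ dv)

  IsFu : LinkSet n → Fin n → Fin n → Fin n → LinkSet n → Set₁
  IsFu F t b vu Fu =
    (∀ ℓ → Fu ℓ → B F vu ℓ) × Covers Fu (PathE t b) ×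
    (∀ (S : LinkSet n) → (∀ ℓ → S ℓ → Fu ℓ) → Covers S (PathE t b) →
       ∀ ℓ → Fu ℓ → S ℓ)

  Pul : Fin n → Fin n → LinkSet n → Link n → Fin n → Set
  Pul t b Fu ℓ c = PathE t b c × (∀ ℓ' → Fu ℓ' → ℓ' ≢ ℓ → ¬ PE ℓ' c)

  -- ℓ₁ ≺_u ℓ₂ : every edge of P_{u,ℓ₁} comes before every edge of P_{u,ℓ₂}
  -- on the t–b path (t an ancestor of b), i.e. is closer to t; for edges of
  -- the t–b path, {c , parent c} comes before {c' , parent c'} iff c is a
  -- strict ancestor of c'.
  Prec : Fin n → Fin n → LinkSet n → Link n → Link n → Set
  Prec t b Fu ℓ₁ ℓ₂ = ∀ c c' → Pul t b Fu ℓ₁ c → Pul t b Fu ℓ₂ c' → StrictAnc c c'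

  InA : Fin n → Fin n → LinkSet n → Link n → Link n → Set
  InA t b Fu ℓ₁ ℓ₂ =
    Fu ℓ₁ × Fu ℓ₂ × Prec t b Fu ℓ₁ ℓ₂ ×
    (∀ ℓ → Fu ℓ → ¬ (Prec t b Fu ℓ₁ ℓ × Prec t b Fu ℓ ℓ₂))

  IsRootedTree : Set
  IsRootedTree = (parent root ≡ root) × (∀ v → Anc root v)

-- For a link ℓ of an inclusion-wise minimal cover F_u of P_u, the private part
-- P_{u,ℓ} is nonempty, and it is convex along the t–b path: an edge between two
-- private edges of ℓ that lay on some other P_ℓ' would force P_ℓ' ∩ P_u inside
-- P_ℓ, so ℓ' could be dropped from F_u. Hence P_{u,ℓ} is a segment, cut out by
-- its topmost and bottommost edges. If ℓ₁ ≺_u ℓ₂, every private edge of ℓ₁ lies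
-- above some edge of P_ℓ₂ and is not on P_ℓ₂; since P_ℓ₂ contains every edge
-- between apex(ℓ₂) and its own edges, the private edges of ℓ₁ lie above
-- apex(ℓ₂), and below apex(ℓ₁) as they are edges of P_ℓ₁.
{-# OPTIONS --safe #-}
module Submission where

open import Defs
open import Data.Nat using (ℕ; zero; suc; _+_; _*_; _∸_; _≤_; _<_; s≤s; s≤s⁻¹; _≤?_)
open import Data.Nat.Properties
  using (≤-refl; ≤-total; ≤∧≢⇒<; n≤0⇒n≡0; <⇒≤; <⇒≱; ≰⇒>; ≮⇒≥; m≤m*n; m∸n+n≡m; anyUpTo?)
open import Data.Nat.Induction using (<-wellFounded)
open import Data.Fin using (Fin; _≟_)
open import Data.Fin.Properties using (any?)
open import Data.Maybe using (Maybe; just; nothing)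
open import Data.Maybe.Properties using (just-injective)
open import Data.Product using (∃; ∃-syntax; _×_; _,_; proj₁; proj₂; uncurry)
open import Data.Product.Properties using (≡-dec)
open import Data.Sum using (_⊎_; inj₁; inj₂; swap)
import Data.Sum as Sum
open import Data.Empty using (⊥-elim)
open import Function using (_∘_)
open import Induction.WellFounded using (Acc; acc)
open import Relation.Nullary using (¬_; Dec; yes; no)
open import Relation.Nullary.Decidable using (_×-dec_; _⊎-dec_; ¬?; map′; decidable-stable)
open import Relation.Unary using (Decidable)
open import Relation.Binary.PropositionalEquality
  using (_≡_; _≢_; refl; sym; trans; cong; subst; module ≡-Reasoning)

open ≡-Reasoning

module _ {P : ℕ → Set} (P? : Decidable P) where

  least-witness : ∀ {k} → P k → ∃[ m ] (P m × ∀ {j} → P j → m ≤ j)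
  least-witness {k} = go k (<-wellFounded k)
    where
    go : ∀ k → Acc _<_ k → P k → ∃[ m ] (P m × ∀ {j} → P j → m ≤ j)
    go k (acc rs) pk with anyUpTo? P? k
    ... | yes (j , j<k , pj) = go j (rs j<k) pj
    ... | no ∄ = k , pk , λ {j} pj → ≮⇒≥ (λ j<k → ∄ (j , j<k , pj))

  greatest-witness : ∀ N → (∀ {k} → P k → k ≤ N) →
                     ∀ {k} → P k → ∃[ m ] (P m × ∀ {j} → P j → j ≤ m)
  greatest-witness N bound pk with P? N
  ... | yes pN = N , pN , bound
  greatest-witness zero bound pk | no ¬pN =
    ⊥-elim (¬pN (subst P (n≤0⇒n≡0 (bound pk)) pk))
  greatest-witness (suc N) bound pk | no ¬pN =
    greatest-witness N (λ pj → s≤s⁻¹ (≤∧≢⇒< (bound pj) λ { refl → ¬pN pj })) pk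

module RootedTree {n : ℕ} (parent : Fin n → Fin n) (r : Fin n)
                  (isTree : Tree.IsRootedTree parent r) where
  open Tree parent r

  root-fixed : parent r ≡ r
  root-fixed = proj₁ isTree

  root-anc : ∀ v → Anc r v
  root-anc = proj₂ isTree

  iter-+ : ∀ j k v → iter (j + k) v ≡ iter j (iter k v)
  iter-+ zero    k v = refl
  iter-+ (suc j) k v = cong parent (iter-+ j k v)

  iter-suc : ∀ k v → iter (suc k) v ≡ iter k (parent v)
  iter-suc zero    v = refl
  iter-suc (suc k) v = cong parent (iter-suc k v)

  iter-∸ : ∀ v {i j} → i ≤ j → iter (j ∸ i) (iter i v) ≡ iter j v
  iter-∸ v {i} {j} i≤j = begin
    iter (j ∸ i) (iter i v) ≡⟨ iter-+ (j ∸ i) i v ⟨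
    iter (j ∸ i + i) v      ≡⟨ cong (λ k → iter k v) (m∸n+n≡m i≤j) ⟩
    iter j v                ∎

  iter-root : ∀ k → iter k r ≡ r
  iter-root zero    = refl
  iter-root (suc k) = trans (cong parent (iter-root k)) root-fixed

  iter-≥-root : ∀ v {k m} → iter k v ≡ r → k ≤ m → iter m v ≡ r
  iter-≥-root v {k} {m} e k≤m = begin
    iter m v                ≡⟨ iter-∸ v k≤m ⟨
    iter (m ∸ k) (iter k v) ≡⟨ cong (iter (m ∸ k)) e ⟩
    iter (m ∸ k) r          ≡⟨ iter-root (m ∸ k) ⟩
    r                       ∎

  iter-periodic : ∀ {p v} → iter p v ≡ v → ∀ m → iter (m * p) v ≡ v
  iter-periodic         e zero    = refl
  iter-periodic {p} {v} e (suc m) = begin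
    iter (p + m * p) v     ≡⟨ iter-+ p (m * p) v ⟩
    iter p (iter (m * p) v) ≡⟨ cong (iter p) (iter-periodic e m) ⟩
    iter p v               ≡⟨ e ⟩
    v                      ∎

  periodic⇒root : ∀ {p v} → iter (suc p) v ≡ v → v ≡ r
  periodic⇒root {p} {v} e with root-anc v
  ... | k , e₀ = begin
    v                  ≡⟨ iter-periodic e k ⟨
    iter (k * suc p) v ≡⟨ iter-≥-root v e₀ (m≤m*n k (suc p)) ⟩
    r                  ∎

  parent-fixed⇒root : ∀ {v} → parent v ≡ v → v ≡ r
  parent-fixed⇒root = periodic⇒root {0}

  Anc-refl : ∀ {v} → Anc v v
  Anc-refl = 0 , refl

  Anc-parent : ∀ v → Anc (parent v) v
  Anc-parent v = 1 , refl

  Anc-trans : ∀ {a b c} → Anc a b → Anc b c → Anc a c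
  Anc-trans {c = c} (i , refl) (j , refl) = i + j , iter-+ i j c

  iter-Anc : ∀ v {i j} → i ≤ j → Anc (iter j v) (iter i v)
  iter-Anc v {i} {j} i≤j = j ∸ i , iter-∸ v i≤j

  Anc-comparable : ∀ {a b v} → Anc a v → Anc b v → Anc a b ⊎ Anc b a
  Anc-comparable {v = v} (i , refl) (j , refl) with ≤-total i j
  ... | inj₁ i≤j = inj₂ (iter-Anc v i≤j)
  ... | inj₂ j≤i = inj₁ (iter-Anc v j≤i)

  Anc-antisym : ∀ {a b} → Anc a b → Anc b a → a ≡ b
  Anc-antisym (zero , refl) _ = refl
  Anc-antisym {a} {b} (suc i , a≡) (j , b≡) = trans a≡r (sym b≡r)
    where
    a-periodic : iter (suc i + j) a ≡ a
    a-periodic = begin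
      iter (suc i + j) a      ≡⟨ iter-+ (suc i) j a ⟩
      iter (suc i) (iter j a) ≡⟨ cong (iter (suc i)) b≡ ⟩
      iter (suc i) b          ≡⟨ a≡ ⟩
      a                       ∎
    a≡r : a ≡ r
    a≡r = periodic⇒root {i + j} a-periodic
    b≡r : b ≡ r
    b≡r = begin
      b        ≡⟨ b≡ ⟨
      iter j a ≡⟨ cong (iter j) a≡r ⟩
      iter j r ≡⟨ iter-root j ⟩
      r        ∎

  Anc-up : ∀ {a v} → Anc a v → a ≢ v → Anc a (parent v)
  Anc-up         (zero  , e) a≢v = ⊥-elim (a≢v (sym e))
  Anc-up {v = v} (suc k , e) _   = k , trans (sym (iter-suc k v)) e

  Anc? : ∀ z v → Dec (Anc z v)
  Anc? z v with root-anc v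
  ... | k₀ , e₀ =
    map′ (λ (k , _ , e) → k , e) bounded (anyUpTo? (λ k → iter k v ≟ z) (suc k₀))
    where
    -- past k₀ the iterates of v stay at r = iter k₀ v
    bounded : Anc z v → ∃[ k ] (k < suc k₀ × iter k v ≡ z)
    bounded (k , e) with k ≤? k₀
    ... | yes k≤k₀ = k , s≤s k≤k₀ , e
    ... | no  k≰k₀ = k₀ , ≤-refl , trans e₀ (trans (sym (iter-≥-root v e₀ (<⇒≤ (≰⇒> k≰k₀)))) e)

  Depth-minimal : ∀ {v d m} → Depth v d → iter m v ≡ r → d ≤ m
  Depth-minimal (_ , below) e = ≮⇒≥ (λ m<d → below _ m<d e)

  depth : ∀ v → ∃ (Depth v)
  depth v with root-anc v
  ... | k₀ , e₀ with least-witness (λ k → iter k v ≟ r) {k₀} e₀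
  ...   | m , e , minimal = m , e , λ j j<m e′ → <⇒≱ j<m (minimal e′)

  Depth-parent : ∀ {v dv dp} → v ≢ r → Depth v dv → Depth (parent v) dp → dp < dv
  Depth-parent {dv = zero}      v≢r (v≡r , _) _  = ⊥-elim (v≢r v≡r)
  Depth-parent {v} {dv = suc d} _   (e   , _) Dp =
    s≤s (Depth-minimal Dp (trans (sym (iter-suc d v)) e))

  PathE? : ∀ a b c → Dec (PathE a b c)
  PathE? a b c = (Anc? c a ×-dec ¬? (Anc? c b)) ⊎-dec (Anc? c b ×-dec ¬? (Anc? c a))

  PathE-root-free : ∀ {a b c} → PathE a b c → c ≢ r
  PathE-root-free (inj₁ (_ , ¬cb)) refl = ¬cb (root-anc _)
  PathE-root-free (inj₂ (_ , ¬ca)) refl = ¬ca (root-anc _)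

  PathE-vertical : ∀ {t b c} → Anc t b → PathE t b c → Anc c b × ¬ Anc c t
  PathE-vertical t≤b (inj₁ (c≤t , ¬c≤b)) = ⊥-elim (¬c≤b (Anc-trans c≤t t≤b))
  PathE-vertical t≤b (inj₂ below)        = below

  PathE⇒¬common : ∀ {x y c} → PathE x y c → ¬ (Anc c x × Anc c y)
  PathE⇒¬common (inj₁ (_ , ¬cy)) (_  , cy) = ¬cy cy
  PathE⇒¬common (inj₂ (_ , ¬cx)) (cx , _)  = ¬cx cx

  ¬PathE⇒common : ∀ {x y z} → ¬ PathE x y z → Anc z x ⊎ Anc z y → Anc z x × Anc z y
  ¬PathE⇒common {x} {y} {z} ¬p (inj₁ zx) =
    zx , decidable-stable (Anc? z y) (λ ¬zy → ¬p (inj₁ (zx , ¬zy)))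
  ¬PathE⇒common {x} {y} {z} ¬p (inj₂ zy) =
    decidable-stable (Anc? z x) (λ ¬zx → ¬p (inj₂ (zy , ¬zx))) , zy

  PathV⇒anc-endpoint : ∀ {x y z} → PathV x y z → Anc z x ⊎ Anc z y
  PathV⇒anc-endpoint (inj₁ refl)                       = inj₁ Anc-refl
  PathV⇒anc-endpoint (inj₂ (inj₁ refl))                = inj₂ Anc-refl
  PathV⇒anc-endpoint (inj₂ (inj₂ (c , pc , inj₁ refl))) = Sum.map proj₁ proj₁ pc
  PathV⇒anc-endpoint (inj₂ (inj₂ (c , pc , inj₂ refl))) =
    Sum.map (Anc-trans (Anc-parent c) ∘ proj₁) (Anc-trans (Anc-parent c) ∘ proj₁) pc

  common⇒strictAnc-PathE : ∀ {w x y c} → Anc w x → Anc w y → PathE x y c → StrictAnc w c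
  common⇒strictAnc-PathE wx wy (inj₁ (cx , ¬cy)) with Anc-comparable wx cx
  ... | inj₁ wc = wc , λ { refl → ¬cy wy }
  ... | inj₂ cw = ⊥-elim (¬cy (Anc-trans cw wy))
  common⇒strictAnc-PathE wx wy (inj₂ p) = common⇒strictAnc-PathE wy wx (inj₁ p)

  PathE-upward : ∀ {x y c c′} → PathE x y c → Anc c′ c → ¬ (Anc c′ x × Anc c′ y) →
                 PathE x y c′
  PathE-upward (inj₁ (cx , _)) c′c ¬both =
    inj₁ (Anc-trans c′c cx , λ c′y → ¬both (Anc-trans c′c cx , c′y))
  PathE-upward (inj₂ (cy , _)) c′c ¬both =
    inj₂ (Anc-trans c′c cy , λ c′x → ¬both (c′x , Anc-trans c′c cy))

  PathE-convex : ∀ {x y a d m} → PathE x y a → PathE x y d → Anc a m → Anc m d →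
                 PathE x y m
  PathE-convex {y = y} {m = m} pa (inj₁ (dx , _)) am md with Anc? m y
  ... | no  ¬my = inj₁ (Anc-trans md dx , ¬my)
  ... | yes my  = ⊥-elim (PathE⇒¬common pa (Anc-trans am (Anc-trans md dx) , Anc-trans am my))
  PathE-convex pa (inj₂ d) am md = swap (PathE-convex (swap pa) (inj₁ d) am md)

  segment⇒PathE : ∀ {a c d} → a ≢ r → Anc a c → Anc c d → PathE (parent a) d c
  segment⇒PathE {a} a≢r ac cd =
    inj₂ (cd , λ c≤pa → a≢r (parent-fixed⇒root (Anc-antisym (Anc-parent a) (Anc-trans ac c≤pa))))

  PathE⇒segment : ∀ {a c d} → Anc a d → PathE (parent a) d c → Anc a c × Anc c d
  PathE⇒segment {a} ad (inj₁ (c≤pa , ¬cd)) = ⊥-elim (¬cd (Anc-trans c≤pa (Anc-trans (Anc-parent a) ad)))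
  PathE⇒segment {a} {c} ad (inj₂ (cd , ¬c≤pa)) with Anc-comparable ad cd
  ... | inj₁ ac = ac , cd
  ... | inj₂ ca with c ≟ a
  ...   | yes refl = Anc-refl , cd
  ...   | no  c≢a  = ⊥-elim (¬c≤pa (Anc-up ca c≢a))

  module _ {S : Fin n → Set} (S? : Decidable S) {b : Fin n} (S⊆chain : ∀ {c} → S c → Anc c b) where

    bottommost : ∀ {c} → S c → ∃[ y ] (S y × ∀ {c} → S c → Anc c y)
    bottommost sc with S⊆chain sc
    ... | k , refl with least-witness (λ k → S? (iter k b)) {k} sc
    ...   | m , sm , minimal = iter m b , sm , below
      where
      below : ∀ {c} → S c → Anc c (iter m b)
      below sc′ with S⊆chain sc′
      ... | j , refl = iter-Anc b (minimal {j} sc′)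

    chain-index-bounded : (∀ {c} → S c → c ≢ r) → ∀ {j} → S (iter j b) → j ≤ proj₁ (root-anc b)
    chain-index-bounded S-root-free sj =
      ≮⇒≥ (λ k₀<j → S-root-free sj (iter-≥-root b (proj₂ (root-anc b)) (<⇒≤ k₀<j)))

    topmost : (∀ {c} → S c → c ≢ r) → ∀ {c} → S c → ∃[ x ] (S x × ∀ {c} → S c → Anc x c)
    topmost S-root-free sc with S⊆chain sc
    ... | k , refl with greatest-witness (λ k → S? (iter k b)) _ (chain-index-bounded S-root-free) {k} sc
    ...   | m , sm , maximal = iter m b , sm , above
      where
      above : ∀ {c} → S c → Anc (iter m b) c
      above sc′ with S⊆chain sc′
      ... | j , refl = iter-Anc b (maximal {j} sc′)

  module _ {ℓ : Link n} {z : Fin n} (apex : IsApex ℓ z) where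

    apex-∉-path : ¬ PE ℓ z
    apex-∉-path pz with depth z | depth (parent z)
    ... | dz , Dz | dp , Dp =
      <⇒≱ (Depth-parent (PathE-root-free pz) Dz Dp)
          (proj₂ apex (parent z) (inj₂ (inj₂ (z , pz , inj₂ refl))) dz dp Dz Dp)

    apex-common-anc : Anc z (proj₁ ℓ) × Anc z (proj₂ ℓ)
    apex-common-anc = ¬PathE⇒common apex-∉-path (PathV⇒anc-endpoint (proj₁ apex))

    apex-strictAnc-path : ∀ {c} → PE ℓ c → StrictAnc z c
    apex-strictAnc-path = uncurry common⇒strictAnc-PathE apex-common-anc

  common⇒anc-apex : ∀ {ℓ z w} → IsApex ℓ z → Anc w (proj₁ ℓ) → Anc w (proj₂ ℓ) → Anc w z
  common⇒anc-apex (inj₁ refl , _)                           wp wq = wp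
  common⇒anc-apex (inj₂ (inj₁ refl) , _)                    wp wq = wq
  common⇒anc-apex ap@(inj₂ (inj₂ (c , pc , inj₁ refl)) , _) wp wq = ⊥-elim (apex-∉-path ap pc)
  common⇒anc-apex (inj₂ (inj₂ (c , pc , inj₂ refl)) , _)    wp wq =
    uncurry Anc-up (common⇒strictAnc-PathE wp wq pc)

  path-below-apex : ∀ {ℓ z c c′} → IsApex ℓ z → PE ℓ c → Anc c′ c → StrictAnc z c′ → PE ℓ c′
  path-below-apex apex pc c′c (zc′ , z≢c′) =
    PathE-upward pc c′c λ (c′p , c′q) → z≢c′ (Anc-antisym zc′ (common⇒anc-apex apex c′p c′q))

  module MinimalCover (t b : Fin n) (t≤b : Anc t b) (Fu : LinkSet n)
                      (cover : Covers Fu (PathE t b))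
                      (minimal : ∀ (S : LinkSet n) → (∀ ℓ → S ℓ → Fu ℓ) →
                                 Covers S (PathE t b) → ∀ ℓ → Fu ℓ → S ℓ) where

    _≟L_ : (ℓ ℓ′ : Link n) → Dec (ℓ ≡ ℓ′)
    _≟L_ = ≡-dec _≟_ _≟_

    Private : Link n → Fin n → Set
    Private = Pul t b Fu

    Rival : Link n → Fin n → Set
    Rival ℓ c = ∃[ ℓ′ ] ((Fu ℓ′ × ℓ′ ≢ ℓ) × PE ℓ′ c)

    below-b : ∀ {c} → PathE t b c → Anc c b
    below-b = proj₁ ∘ PathE-vertical t≤b

    irredundant : ∀ {ℓ} → Fu ℓ → ¬ (∀ c → PathE t b c → PE ℓ c → Rival ℓ c)
    irredundant {ℓ} fℓ rivalled = proj₂ (minimal _ (λ _ → proj₁) cover-without-ℓ ℓ fℓ) refl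
      where
      cover-without-ℓ : Covers (λ ℓ′ → Fu ℓ′ × ℓ′ ≢ ℓ) (PathE t b)
      cover-without-ℓ c pc with cover c pc
      ... | ℓ′ , fℓ′ , pℓ′ with ℓ′ ≟L ℓ
      ...   | yes refl = rivalled c pc pℓ′
      ...   | no  ℓ′≢ℓ = ℓ′ , (fℓ′ , ℓ′≢ℓ) , pℓ′

    -- Fu need not be decidable; the links chosen to cover the edges of P_u enumerate it.
    chosen : Fin n → Maybe (Link n)
    chosen c with PathE? t b c
    ... | yes pc = just (proj₁ (cover c pc))
    ... | no  _  = nothing

    chosen-∈ : ∀ {c ℓ} → chosen c ≡ just ℓ → Fu ℓ
    chosen-∈ {c} e with PathE? t b c
    ... | yes pc = subst Fu (just-injective e) (proj₁ (proj₂ (cover c pc)))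

    chosen-covers : ∀ {c} → PathE t b c → ∃[ ℓ ] (chosen c ≡ just ℓ × PE ℓ c)
    chosen-covers {c} pc′ with PathE? t b c
    ... | yes pc  = proj₁ (cover c pc) , refl , proj₂ (proj₂ (cover c pc))
    ... | no  ¬pc = ⊥-elim (¬pc pc′)

    every-link-chosen : ∀ {ℓ} → Fu ℓ → ∃[ c ] (chosen c ≡ just ℓ)
    every-link-chosen {ℓ} = minimal (λ ℓ → ∃[ c ] (chosen c ≡ just ℓ)) (λ _ → chosen-∈ ∘ proj₂) chosen-cover ℓ
      where
      chosen-cover : Covers (λ ℓ → ∃[ c ] (chosen c ≡ just ℓ)) (PathE t b)
      chosen-cover c pc with chosen-covers pc
      ... | ℓ′ , e , pℓ′ = ℓ′ , (c , e) , pℓ′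

    chosen-rival? : ∀ ℓ c c′ → Dec (∃[ ℓ′ ] (chosen c′ ≡ just ℓ′ × ℓ′ ≢ ℓ × PE ℓ′ c))
    chosen-rival? ℓ c c′ with chosen c′
    ... | nothing = no λ { (_ , () , _) }
    ... | just ℓ′ = map′ (λ (ℓ′≢ℓ , pℓ′) → ℓ′ , refl , ℓ′≢ℓ , pℓ′)
                         (λ { (_ , refl , ℓ′≢ℓ , pℓ′) → ℓ′≢ℓ , pℓ′ })
                         (¬? (ℓ′ ≟L ℓ) ×-dec PathE? (proj₁ ℓ′) (proj₂ ℓ′) c)

    Rival? : ∀ ℓ c → Dec (Rival ℓ c)
    Rival? ℓ c = map′ (λ (_ , ℓ′ , e , ℓ′≢ℓ , pℓ′) → ℓ′ , (chosen-∈ e , ℓ′≢ℓ) , pℓ′)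
                      (λ (ℓ′ , (fℓ′ , ℓ′≢ℓ) , pℓ′) →
                         let (c′ , e) = every-link-chosen fℓ′ in c′ , ℓ′ , e , ℓ′≢ℓ , pℓ′)
                      (any? (chosen-rival? ℓ c))

    ¬Rival⇒unrivalled : ∀ {ℓ c} → ¬ Rival ℓ c → ∀ ℓ′ → Fu ℓ′ → ℓ′ ≢ ℓ → ¬ PE ℓ′ c
    ¬Rival⇒unrivalled ¬rival ℓ′ fℓ′ ℓ′≢ℓ pℓ′ = ¬rival (ℓ′ , (fℓ′ , ℓ′≢ℓ) , pℓ′)

    Private? : ∀ ℓ c → Dec (Private ℓ c)
    Private? ℓ c = PathE? t b c ×-dec map′ ¬Rival⇒unrivalled unrivalled⇒¬Rival (¬? (Rival? ℓ c))
      where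
      unrivalled⇒¬Rival : (∀ ℓ′ → Fu ℓ′ → ℓ′ ≢ ℓ → ¬ PE ℓ′ c) → ¬ Rival ℓ c
      unrivalled⇒¬Rival unrivalled (ℓ′ , (fℓ′ , ℓ′≢ℓ) , pℓ′) = unrivalled ℓ′ fℓ′ ℓ′≢ℓ pℓ′

    Private⇒PE : ∀ {ℓ c} → Private ℓ c → PE ℓ c
    Private⇒PE {ℓ} {c} (pc , priv) with cover c pc
    ... | ℓ′ , fℓ′ , pℓ′ with ℓ′ ≟L ℓ
    ...   | yes refl = pℓ′
    ...   | no  ℓ′≢ℓ = ⊥-elim (priv ℓ′ fℓ′ ℓ′≢ℓ pℓ′)

    Private-nonempty : ∀ {ℓ} → Fu ℓ → ∃ (Private ℓ)
    Private-nonempty {ℓ} fℓ with any? (Private? ℓ)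
    ... | yes ∃priv = ∃priv
    ... | no  ∄priv = ⊥-elim (irredundant fℓ λ c pc _ →
            decidable-stable (Rival? ℓ c) λ ¬rival → ∄priv (c , pc , ¬Rival⇒unrivalled ¬rival))

    Private-convex : ∀ {ℓ a d m} → Fu ℓ → Private ℓ a → Private ℓ d → Anc a m → Anc m d →
                     Private ℓ m
    Private-convex {ℓ} {a} {d} {m} fℓ (pa , priv-a) (pd , priv-d) am md = pm , unrivalled
      where
      pm : PathE t b m
      pm = inj₂ (Anc-trans md (below-b pd) ,
                 λ m≤t → proj₂ (PathE-vertical t≤b pa) (Anc-trans am m≤t))
      ℓ-a : PE ℓ a
      ℓ-a = Private⇒PE (pa , priv-a)
      ℓ-d : PE ℓ d
      ℓ-d = Private⇒PE (pd , priv-d)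
      -- P_ℓ′ ∩ P_u would lie strictly between a and d, hence inside P_ℓ
      unrivalled : ∀ ℓ′ → Fu ℓ′ → ℓ′ ≢ ℓ → ¬ PE ℓ′ m
      unrivalled ℓ′ fℓ′ ℓ′≢ℓ ℓ′-m = irredundant fℓ′ rivalled
        where
        rivalled : ∀ c → PathE t b c → PE ℓ′ c → Rival ℓ′ c
        rivalled c pc ℓ′-c with Anc-comparable (below-b pc) (below-b pa)
        ... | inj₁ ca = ⊥-elim (priv-a ℓ′ fℓ′ ℓ′≢ℓ (PathE-convex ℓ′-c ℓ′-m ca am))
        ... | inj₂ ac with Anc-comparable (below-b pc) (below-b pd)
        ...   | inj₂ dc = ⊥-elim (priv-d ℓ′ fℓ′ ℓ′≢ℓ (PathE-convex ℓ′-m ℓ′-c md dc))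
        ...   | inj₁ cd = ℓ , (fℓ , ℓ′≢ℓ ∘ sym) , PathE-convex ℓ-a ℓ-d ac cd

    Private-segment : ∀ {ℓ} → Fu ℓ → ∃[ x ] ∃[ y ]
      ((∀ c → Private ℓ c → PathE x y c) × (∀ c → PathE x y c → Private ℓ c))
    Private-segment {ℓ} fℓ with Private-nonempty fℓ
    ... | _ , pc with topmost (Private? ℓ) (below-b ∘ proj₁) (PathE-root-free ∘ proj₁) pc
                    | bottommost (Private? ℓ) (below-b ∘ proj₁) pc
    ...   | top , p-top , top≤ | bot , p-bot , ≤bot =
      parent top , bot ,
      (λ c p → segment⇒PathE (PathE-root-free (proj₁ p-top)) (top≤ p) (≤bot p)) ,
      (λ c p → uncurry (Private-convex fℓ p-top p-bot) (PathE⇒segment (top≤ p-bot) p))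

    module _ {ℓ₁ ℓ₂ : Link n} (f₁ : Fu ℓ₁) (f₂ : Fu ℓ₂) (ℓ₁≺ℓ₂ : Prec t b Fu ℓ₁ ℓ₂) where

      Prec⇒≢ : ℓ₂ ≢ ℓ₁
      Prec⇒≢ refl with Private-nonempty f₁
      ... | c , pc = proj₂ (ℓ₁≺ℓ₂ c c pc pc) refl

      Private-below-apex : ∀ {z₂ c} → IsApex ℓ₂ z₂ → Private ℓ₁ c → Anc c z₂
      Private-below-apex {z₂} {c} apex (pc , priv) with Private-nonempty f₂
      ... | c₂ , pc₂ with ℓ₁≺ℓ₂ c c₂ (pc , priv) pc₂ | apex-strictAnc-path apex (Private⇒PE pc₂)
      ...   | (cc₂ , _) | (z₂c₂ , _) with Anc-comparable cc₂ z₂c₂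
      ...     | inj₁ cz₂ = cz₂
      ...     | inj₂ z₂c with z₂ ≟ c
      ...       | yes refl = Anc-refl
      ...       | no  z₂≢c =
        ⊥-elim (priv ℓ₂ f₂ Prec⇒≢ (path-below-apex apex (Private⇒PE pc₂) cc₂ (z₂c , z₂≢c)))

      apex-strictAnc : ∀ {z₁ z₂} → IsApex ℓ₁ z₁ → IsApex ℓ₂ z₂ → StrictAnc z₁ z₂
      apex-strictAnc apex₁ apex₂ with Private-nonempty f₁
      ... | c₁ , pc₁ with apex-strictAnc-path apex₁ (Private⇒PE pc₁) | Private-below-apex apex₂ pc₁
      ...   | z₁c₁ , z₁≢c₁ | c₁z₂ = Anc-trans z₁c₁ c₁z₂ , λ { refl → z₁≢c₁ (Anc-antisym z₁c₁ c₁z₂) }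

      Private⇒PathE-apexes : ∀ {z₁ z₂ c} → IsApex ℓ₁ z₁ → IsApex ℓ₂ z₂ → Private ℓ₁ c →
                             PathE z₁ z₂ c
      Private⇒PathE-apexes apex₁ apex₂ pc with apex-strictAnc-path apex₁ (Private⇒PE pc)
      ... | z₁c , z₁≢c =
        inj₂ (Private-below-apex apex₂ pc , λ cz₁ → z₁≢c (Anc-antisym z₁c cz₁))

      Private-segment-between-apexes : ∀ {z₁ z₂} → IsApex ℓ₁ z₁ → IsApex ℓ₂ z₂ → ∃[ x ] ∃[ y ]
          ((∀ c → Private ℓ₁ c → PathE x y c)
           × (∀ c → PathE x y c → Private ℓ₁ c)
           × (∀ c → PathE x y c → PathE z₁ z₂ c))
      Private-segment-between-apexes apex₁ apex₂ =
        let (x , y , ⊆segment , segment⊆) = Private-segment f₁ in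
        x , y , ⊆segment , segment⊆ , λ c p → Private⇒PathE-apexes apex₁ apex₂ (segment⊆ c p)

lemma7 : ∀ {n : ℕ} (parent : Fin n → Fin n) (r : Fin n) →
    let open Tree parent r in
    IsRootedTree →
    (L F : LinkSet n) →
    (∀ ℓ → L ℓ → proj₁ ℓ ≢ proj₂ ℓ) →
    (∀ ℓ → F ℓ → L ℓ) →
    Covers F IsEdge →
    (t b : Fin n) → (L (t , b) ⊎ L (b , t)) → Anc t b →
    (vu : Fin n) → IsVu F t b vu →
    (Fu : LinkSet n) → IsFu F t b vu Fu →
    (ℓ₁ ℓ₂ : Link n) → InA t b Fu ℓ₁ ℓ₂ →
    (∀ z₁ z₂ → IsApex ℓ₁ z₁ → IsApex ℓ₂ z₂ → StrictAnc z₁ z₂)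
    × (∀ z₁ z₂ → IsApex ℓ₁ z₁ → IsApex ℓ₂ z₂ →
        ∃[ x ] ∃[ y ]
          ((∀ c → Pul t b Fu ℓ₁ c → PathE x y c)
           × (∀ c → PathE x y c → Pul t b Fu ℓ₁ c)
           × (∀ c → PathE x y c → PathE z₁ z₂ c)))
lemma7 parent r isTree _ _ _ _ _ t b _ t≤b _ _ Fu (_ , cover , minimal) _ _ (f₁ , f₂ , ℓ₁≺ℓ₂ , _) =
  (λ _ _ → apex-strictAnc f₁ f₂ ℓ₁≺ℓ₂) , (λ _ _ → Private-segment-between-apexes f₁ f₂ ℓ₁≺ℓ₂)
  where
  open RootedTree parent r isTree
  open MinimalCover t b t≤b Fu cover minimal
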